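{- Let $G$ be a finite, simple, connected graph with $A(G)\neq\emptyset$, and let $G^*$, $D^*$ and $md(G^*)$ be as defined in the context. If $md(G^*)\leq 1$, then $mc(G)=2$; if $md(G^*)\geq 2$, then $mc(G)=md(G^*)$.
   Context: A matching of a graph is a set of pairwise vertex-disjoint edges. For a graph $G$, a $k$-matching cover of $G$ is a union of $k$ matchings of $G$ that covers every vertex of $G$ (i.e. every vertex is an endpoint of some edge in the union); the matching cover number $mc(G)$ is the minimum $k$ such that $G$ has a $k$-matching cover. Define $D(G)$ to be the set of vertices $x$ such that some maximum matching of $G$ does not cover $x$; $A(G)=N_G(D(G))$ is the set of vertices not in $D(G)$ that have a neighbour in $D(G)$; and $C(G)=V(G)\setminus(A(G)\cup D(G))$. When $A(G)\neq\emptyset$, let $D^*$ be the set of isolated vertices of the induced subgraph $G[D(G)]$, and let $G^*$ be the graph obtained from $G$ by deleting the vertices of the nontrivial (at least two-vertex) components of $G[D(G)]$, deleting the vertices of $C(G)$, and deleting all edges with both ends in $A(G)$; thus $G^*$ is a bipartite subgraph of $G$ with bipartition $(A(G),D^*)$. A $k$-matching $D^*$-cover of $G^*$ is a union of $k$ matchings of $G^*$ that covers every vertex of $D^*$; $md(G^*)$ is the minimum $k$ for which $G^*$ has a $k$-matching $D^*$-cover (so $md(G^*)=0$ if $D^*=\emptyset$). -}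

module Defs where

open import Data.Nat using (ℕ; _≤_)
open import Data.Fin using (Fin)
open import Data.Product using (_×_; _,_; Σ; ∃; ∃-syntax)
open import Data.Sum using (_⊎_)
open import Data.List using (List; []; _∷_; length; concatMap)
open import Data.List.Membership.Propositional using (_∈_)
open import Data.List.Relation.Unary.All using (All)
open import Data.List.Relation.Unary.Unique.Propositional using (Unique)
open import Relation.Nullary using (¬_)
open import Relation.Binary using (Decidable)

record Graph : Set₁ where
  field
    n     : ℕ
    Adj   : Fin n → Fin n → Set
    adj?  : Decidable Adj
    sym   : ∀ {u v} → Adj u v → Adj v u
    irrefl : ∀ {u} → ¬ Adj u u

open Graph public

data Reach (G : Graph) : Fin (n G) → Fin (n G) → Set where
  here : ∀ {u} → Reach G u u
  step : ∀ {u w v} → Adj G u w → Reach G w v → Reach G u v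

Connected : Graph → Set
Connected G = ∀ u v → Reach G u v

-- A matching of E is a list of edges of E whose endpoints are pairwise
-- distinct (so the edges are pairwise vertex-disjoint and distinct).
endpoints : ∀ {m} → List (Fin m × Fin m) → List (Fin m)
endpoints = concatMap (λ { (u , v) → u ∷ v ∷ [] })

IsMatching : ∀ {m} → (Fin m → Fin m → Set) → List (Fin m × Fin m) → Set
IsMatching E M = All (λ { (u , v) → E u v }) M × Unique (endpoints M)

Covers : ∀ {m} → List (Fin m × Fin m) → Fin m → Set
Covers M x = x ∈ endpoints M

module _ (G : Graph) where
  private
    V = Fin (n G)
    E = Adj G

  IsMaxMatching : List (V × V) → Set
  IsMaxMatching M = IsMatching E M × (∀ M' → IsMatching E M' → length M' ≤ length M)

  DG : V → Set
  DG x = ∃[ M ] (IsMaxMatching M × ¬ Covers M x)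

  AG : V → Set
  AG x = ¬ DG x × ∃[ y ] (Adj G x y × DG y)

  CG : V → Set
  CG x = ¬ AG x × ¬ DG x

  InNontrivialD : V → Set
  InNontrivialD x = DG x × ∃[ y ] (Adj G x y × DG y)

  DStar : V → Set
  DStar x = DG x × ¬ (∃[ y ] (Adj G x y × DG y))

  VStar : V → Set
  VStar x = ¬ InNontrivialD x × ¬ CG x

  -- edges of G* : edges of G with both ends in V(G*), not both in A(G).
  -- (G* is represented as a spanning edge relation on Fin n; the deleted
  -- vertices have no incident G*-edges, which does not affect matchings.)
  EStar : V → V → Set
  EStar u v = Adj G u v × VStar u × VStar v × ¬ (AG u × AG v)

  HasMatchingCover : ℕ → Set
  HasMatchingCover k = Σ (Fin k → List (V × V)) λ Ms →
    (∀ i → IsMatching E (Ms i)) × (∀ x → ∃[ i ] Covers (Ms i) x)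

  IsMC : ℕ → Set
  IsMC m = HasMatchingCover m × (∀ k → HasMatchingCover k → m ≤ k)

  HasMatchingDCover : ℕ → Set
  HasMatchingDCover k = Σ (Fin k → List (V × V)) λ Ms →
    (∀ i → IsMatching EStar (Ms i)) × (∀ x → DStar x → ∃[ i ] Covers (Ms i) x)

  IsMD : ℕ → Set
  IsMD m = HasMatchingDCover m × (∀ k → HasMatchingDCover k → m ≤ k)

module Submission where

-- Switching along alternating paths shows that every matching is covered by some maximum
-- matching, that a maximum matching missing y ∈ D(G) leaves no room for a perfect matching
-- (so mc(G) ≥ 2), and that no maximum matching misses two neighbours of a vertex of D(G).
-- Restricting each matching of a cover of G to its edges at D* gives a D*-cover of G*, so
-- mc(G) ≥ md(G*). Conversely, given a D*-cover M₁, …, M_k of G* with k ≥ 2 (pad with empty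
-- matchings if md(G*) ≤ 1), replace M₁ by a maximum matching N covering it; N covers all of
-- A(G) ∪ C(G). Each vertex missed by N in a nontrivial component of G[D(G)] is joined to a
-- D(G)-neighbour covered by N; these edges are pairwise disjoint and avoid G*, so they can be
-- added to M₂. What remains missed by N lies in D* and is covered by M₂, …, M_k.

open import Defs
open import Data.Nat using (ℕ; zero; suc; _≤_; _≤′_; ≤′-refl; ≤′-step; z≤n; s≤s)
open import Data.Nat.Properties using (≤-antisym; 1+n≰n; suc-injective; ≤⇒≤′; ≤-trans; n≤1+n)
open import Data.Fin using (Fin; zero; suc; _≟_)
open import Data.Fin.Properties using (any?)
open import Data.Product using (_×_; _,_; ∃-syntax; proj₁; proj₂)
import Data.Product as Product
open import Data.Sum using (_⊎_; inj₁; inj₂; [_,_])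
open import Data.Empty using (⊥; ⊥-elim)
open import Data.List using (List; []; _∷_; length; _++_; allFin)
open import Data.List.Properties using (concatMap-++)
open import Data.List.Membership.Propositional using (_∈_)
open import Data.List.Membership.Propositional.Properties using (∈-allFin; ∈-++⁺ˡ; ∈-++⁺ʳ)
import Data.List.Membership.DecPropositional as DecMembership
open import Data.List.Relation.Unary.Any using (here; there)
open import Data.List.Relation.Unary.All using ([]; _∷_; all?)
import Data.List.Relation.Unary.All as All
open import Data.List.Relation.Unary.All.Properties using (¬Any⇒All¬; All¬⇒¬Any) renaming (++⁺ to All-++⁺)
open import Data.List.Relation.Unary.AllPairs using ([]; _∷_)
open import Data.List.Relation.Unary.Unique.Propositional using (Unique)
open import Data.List.Relation.Unary.Unique.Propositional.Properties using (allFin⁺) renaming (++⁺ to Unique-++⁺)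
import Data.List.Relation.Unary.Unique.DecPropositional as DecUnique
open import Function using (_∘_)
open import Relation.Nullary using (¬_; Dec; yes; no; ¬?)
open import Relation.Nullary.Decidable using (_×-dec_)
open import Relation.Binary using (Decidable; Symmetric)
open import Relation.Binary.PropositionalEquality using (_≡_; _≢_; refl; trans; cong; subst)
  renaming (sym to ≡-sym)

Edges : ℕ → Set
Edges m = List (Fin m × Fin m)

module _ {m : ℕ} where

  _covers?_ : (M : Edges m) (x : Fin m) → Dec (Covers M x)
  M covers? x = x ∈? endpoints M
    where open DecMembership (_≟_ {m})

  ∉-∷ : ∀ {u v x} {M : Edges m} → x ≢ u → x ≢ v → ¬ Covers M x → ¬ Covers ((u , v) ∷ M) x
  ∉-∷ x≢u _   _   (here x≡u)         = x≢u x≡u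
  ∉-∷ _   x≢v _   (there (here x≡v)) = x≢v x≡v
  ∉-∷ _   _   x∉M (there (there c))  = x∉M c

  covers-∷⁺ : ∀ {u v} {A B : Edges m} → (∀ {x} → Covers A x → Covers B x) →
              ∀ {x} → Covers ((u , v) ∷ A) x → Covers ((u , v) ∷ B) x
  covers-∷⁺ _   (here e)          = here e
  covers-∷⁺ _   (there (here e))  = there (here e)
  covers-∷⁺ A⊆B (there (there c)) = there (there (A⊆B c))

  endpoints-++ : (A B : Edges m) → endpoints (A ++ B) ≡ endpoints A ++ endpoints B
  endpoints-++ = concatMap-++ _

  covers-++⁺ˡ : ∀ {A B : Edges m} {x} → Covers A x → Covers (A ++ B) x
  covers-++⁺ˡ {A} {B} c = subst (_ ∈_) (≡-sym (endpoints-++ A B)) (∈-++⁺ˡ c)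

  covers-++⁺ʳ : ∀ (A : Edges m) {B x} → Covers B x → Covers (A ++ B) x
  covers-++⁺ʳ A {B} c = subst (_ ∈_) (≡-sym (endpoints-++ A B)) (∈-++⁺ʳ (endpoints A) c)

  any-list-of-length? : ∀ L (Q : Edges m → Set) → (∀ l → Dec (Q l)) → Dec (∃[ l ] length l ≡ L × Q l)
  any-list-of-length? zero Q Q? with Q? []
  ... | yes q = yes ([] , refl , q)
  ... | no ¬q = no λ { ([] , _ , q) → ¬q q ; (_ ∷ _ , () , _) }
  any-list-of-length? (suc L) Q Q?
    with any? (λ u → any? (λ v → any-list-of-length? L (Q ∘ ((u , v) ∷_)) (Q? ∘ ((u , v) ∷_))))
  ... | yes (u , v , l , len , q) = yes ((u , v) ∷ l , cong suc len , q)
  ... | no none = no λ { ([] , () , _) ; ((u , v) ∷ l , len , q) → none (u , v , l , suc-injective len , q) }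

module _ {m : ℕ} {E : Fin m → Fin m → Set} where

  matching-∷ : ∀ {u v} {M : Edges m} → E u v → u ≢ v → ¬ Covers M u → ¬ Covers M v →
               IsMatching E M → IsMatching E ((u , v) ∷ M)
  matching-∷ uv u≢v u∉M v∉M (edges , unique) =
    uv ∷ edges , (u≢v ∷ ¬Any⇒All¬ _ u∉M) ∷ ¬Any⇒All¬ _ v∉M ∷ unique

  matching-∷⁻ : ∀ {u v} {M : Edges m} → IsMatching E ((u , v) ∷ M) →
                E u v × u ≢ v × ¬ Covers M u × ¬ Covers M v × IsMatching E M
  matching-∷⁻ (uv ∷ edges , (u≢v ∷ u∉M) ∷ v∉M ∷ unique) =
    uv , u≢v , All¬⇒¬Any u∉M , All¬⇒¬Any v∉M , edges , unique

  matching-++ : ∀ {A B : Edges m} → IsMatching E A → IsMatching E B →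
                (∀ {x} → Covers A x → ¬ Covers B x) → IsMatching E (A ++ B)
  matching-++ {A} {B} (edgesA , uniqueA) (edgesB , uniqueB) disjoint =
    All-++⁺ edgesA edgesB ,
    subst Unique (≡-sym (endpoints-++ A B)) (Unique-++⁺ uniqueA uniqueB λ (a , b) → disjoint a b)

  matching-mono : ∀ {F : Fin m → Fin m → Set} {M : Edges m} →
                  (∀ {u v} → E u v → F u v) → IsMatching E M → IsMatching F M
  matching-mono E⊆F (edges , unique) = All.map (λ { {u , v} → E⊆F }) edges , unique

  covered-satisfies : ∀ {P : Fin m → Set} {M : Edges m} → (∀ {u v} → E u v → P u × P v) →
                      IsMatching E M → ∀ {x} → Covers M x → P x
  covered-satisfies {M = (u , v) ∷ _} ends (uv ∷ _ , _) (here refl)         = proj₁ (ends uv)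
  covered-satisfies {M = (u , v) ∷ _} ends (uv ∷ _ , _) (there (here refl)) = proj₂ (ends uv)
  covered-satisfies {M = (u , v) ∷ _} ends (_ ∷ edges , _ ∷ _ ∷ unique) (there (there c)) =
    covered-satisfies ends (edges , unique) c

  matching? : Decidable E → (M : Edges m) → Dec (IsMatching E M)
  matching? E? M = all? (λ { (u , v) → E? u v }) M ×-dec unique? (endpoints M)
    where open DecUnique (_≟_ {m})

  record MatchedAt (M : Edges m) (x : Fin m) : Set where
    field
      partner       : Fin m
      rest          : Edges m
      edge          : E x partner
      x≢partner     : x ≢ partner
      rest-matching : IsMatching E rest
      length-rest   : length M ≡ suc (length rest)
      x∈M           : Covers M x
      partner∈M     : Covers M partner
      x∉rest        : ¬ Covers rest x
      partner∉rest  : ¬ Covers rest partner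
      covers-rest   : ∀ {y} → Covers rest y → Covers M y
      covers-split  : ∀ {y} → Covers M y → y ≡ x ⊎ y ≡ partner ⊎ Covers rest y

  open MatchedAt using (partner; rest)

  matchedAt : Symmetric E → ∀ {M x} → IsMatching E M → Covers M x → MatchedAt M x
  matchedAt E-sym {(u , v) ∷ M} mat c with matching-∷⁻ mat
  matchedAt E-sym {(u , v) ∷ M} mat c@(here refl) | uv , u≢v , u∉M , v∉M , matM = record
    { partner = v ; rest = M ; edge = uv ; x≢partner = u≢v ; rest-matching = matM ; length-rest = refl
    ; x∈M = c ; partner∈M = there (here refl) ; x∉rest = u∉M ; partner∉rest = v∉M
    ; covers-rest = there ∘ there
    ; covers-split = λ { (here e) → inj₁ e ; (there (here e)) → inj₂ (inj₁ e) ; (there (there c)) → inj₂ (inj₂ c) } }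
  matchedAt E-sym {(u , v) ∷ M} mat c@(there (here refl)) | uv , u≢v , u∉M , v∉M , matM = record
    { partner = u ; rest = M ; edge = E-sym uv ; x≢partner = u≢v ∘ ≡-sym ; rest-matching = matM ; length-rest = refl
    ; x∈M = c ; partner∈M = here refl ; x∉rest = v∉M ; partner∉rest = u∉M
    ; covers-rest = there ∘ there
    ; covers-split = λ { (here e) → inj₂ (inj₁ e) ; (there (here e)) → inj₁ e ; (there (there c)) → inj₂ (inj₂ c) } }
  matchedAt E-sym {(u , v) ∷ M} mat c@(there (there c′)) | uv , u≢v , u∉M , v∉M , matM = record
    { partner = R.partner ; rest = (u , v) ∷ R.rest ; edge = R.edge ; x≢partner = R.x≢partner
    ; rest-matching = matching-∷ uv u≢v (u∉M ∘ R.covers-rest) (v∉M ∘ R.covers-rest) R.rest-matching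
    ; length-rest = cong suc R.length-rest
    ; x∈M = c ; partner∈M = there (there R.partner∈M)
    ; x∉rest = ∉-∷ {M = R.rest} (λ { refl → u∉M c′ }) (λ { refl → v∉M c′ }) R.x∉rest
    ; partner∉rest = ∉-∷ {M = R.rest} (λ { refl → u∉M R.partner∈M }) (λ { refl → v∉M R.partner∈M }) R.partner∉rest
    ; covers-rest = covers-∷⁺ {A = R.rest} {B = M} R.covers-rest
    ; covers-split = split }
    where
    module R = MatchedAt (matchedAt E-sym matM c′)
    split : ∀ {y} → Covers ((u , v) ∷ M) y → y ≡ _ ⊎ y ≡ R.partner ⊎ Covers ((u , v) ∷ R.rest) y
    split (here e)          = inj₂ (inj₂ (here e))
    split (there (here e))  = inj₂ (inj₂ (there (here e)))
    split (there (there c)) with R.covers-split c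
    ... | inj₁ e          = inj₁ e
    ... | inj₂ (inj₁ e)   = inj₂ (inj₁ e)
    ... | inj₂ (inj₂ c′)  = inj₂ (inj₂ (there (there c′)))

  -- For a covered by P and missed by N, an alternating path a = v₀ v₁ … with v₀v₁ ∈ P, v₁v₂ ∈ N, …
  -- either ends at a vertex missed by N, so that N ⊕ path is larger than N (augmenting), or ends at
  -- a vertex b missed by P, and then N′ = N ⊕ path and P′ = P ⊕ path (switching).
  record Switch (P N : Edges m) (a b : Fin m) : Set where
    field
      N′           : Edges m
      N′-matching  : IsMatching E N′
      N′-length    : length N′ ≡ length N
      N′-covers⁻   : ∀ {x} → Covers N′ x → (Covers N x ⊎ x ≡ a) × x ≢ b
      N′-covers⁺   : ∀ {x} → Covers N x ⊎ x ≡ a → x ≢ b → Covers N′ x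
      P′           : Edges m
      P′-matching  : IsMatching E P′
      P′-length    : length P′ ≡ length P
      P′-covers⁻   : ∀ {x} → Covers P′ x → (Covers P x ⊎ x ≡ b) × x ≢ a
      end-free     : ¬ Covers P b
      end-covered  : Covers N b ⊎ b ≡ a

  data Alternation (P N : Edges m) (a : Fin m) : Set where
    augmenting : (N′ : Edges m) → IsMatching E N′ → length N′ ≡ suc (length N) →
                 (∀ {x} → Covers N′ x → Covers N x ⊎ Covers P x) → Alternation P N a
    switching  : (b : Fin m) → Switch P N a b → Alternation P N a

  switch-refl : ∀ {P N : Edges m} {a} → IsMatching E P → IsMatching E N →
                ¬ Covers P a → ¬ Covers N a → Switch P N a a
  switch-refl matP matN a∉P a∉N = record
    { N′ = _ ; N′-matching = matN ; N′-length = refl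
    ; N′-covers⁻ = λ c → inj₁ c , λ { refl → a∉N c }
    ; N′-covers⁺ = λ { (inj₁ c) _ → c ; (inj₂ refl) a≢a → ⊥-elim (a≢a refl) }
    ; P′ = _ ; P′-matching = matP ; P′-length = refl
    ; P′-covers⁻ = λ c → inj₁ c , λ { refl → a∉P c }
    ; end-free = a∉P ; end-covered = inj₂ refl }

  -- Prepending the edges a–p of P and p–q of N to the alternating path from q.
  switch-∷ : ∀ {P N : Edges m} {a b} (ep : MatchedAt P a) (en : MatchedAt N (partner ep)) →
             ¬ Covers N a → Covers P (partner en) ⊎ partner en ≡ b →
             Switch (rest ep) (rest en) (partner en) b → Switch P N a b
  switch-∷ {P} {N} {a} {b} ep en a∉N q∈P⊎q≡b sw = record
    { N′ = (a , EP.partner) ∷ S.N′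
    ; N′-matching = matching-∷ EP.edge EP.x≢partner a∉N″ p∉N″ S.N′-matching
    ; N′-length = trans (cong suc S.N′-length) (≡-sym EN.length-rest)
    ; N′-covers⁻ = N′-covers⁻
    ; N′-covers⁺ = N′-covers⁺
    ; P′ = (EP.partner , EN.partner) ∷ S.P′
    ; P′-matching = matching-∷ EN.edge EN.x≢partner p∉P″ q∉P″ S.P′-matching
    ; P′-length = trans (cong suc S.P′-length) (≡-sym EP.length-rest)
    ; P′-covers⁻ = P′-covers⁻
    ; end-free = b∉P
    ; end-covered = inj₁ b∈N }
    where
    module EP = MatchedAt ep
    module EN = MatchedAt en
    module S = Switch sw

    rest⊎q⊆N : ∀ {x} → Covers EN.rest x ⊎ x ≡ EN.partner → Covers N x
    rest⊎q⊆N = [ EN.covers-rest , (λ { refl → EN.partner∈M }) ]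

    b∈N : Covers N b
    b∈N = rest⊎q⊆N S.end-covered

    b≢a : b ≢ a
    b≢a refl = a∉N b∈N

    b≢p : b ≢ EP.partner
    b≢p refl = [ EN.x∉rest , EN.x≢partner ] S.end-covered

    q≢a : EN.partner ≢ a
    q≢a refl = a∉N EN.partner∈M

    b∉P : ¬ Covers P b
    b∉P b∈P = [ b≢a , [ b≢p , S.end-free ] ] (EP.covers-split b∈P)

    a∉N″ : ¬ Covers S.N′ a
    a∉N″ c = [ a∉N ∘ EN.covers-rest , q≢a ∘ ≡-sym ] (proj₁ (S.N′-covers⁻ c))

    p∉N″ : ¬ Covers S.N′ EP.partner
    p∉N″ c = [ EN.x∉rest , EN.x≢partner ] (proj₁ (S.N′-covers⁻ c))

    p∉P″ : ¬ Covers S.P′ EP.partner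
    p∉P″ c = [ EP.partner∉rest , b≢p ∘ ≡-sym ] (proj₁ (S.P′-covers⁻ c))

    q∉P″ : ¬ Covers S.P′ EN.partner
    q∉P″ c = proj₂ (S.P′-covers⁻ c) refl

    N′-covers⁻ : ∀ {x} → Covers ((a , EP.partner) ∷ S.N′) x → (Covers N x ⊎ x ≡ a) × x ≢ b
    N′-covers⁻ (here refl)         = inj₂ refl , b≢a ∘ ≡-sym
    N′-covers⁻ (there (here refl)) = inj₁ EN.x∈M , b≢p ∘ ≡-sym
    N′-covers⁻ (there (there c))   = Product.map₁ (inj₁ ∘ rest⊎q⊆N) (S.N′-covers⁻ c)

    N′-covers⁺ : ∀ {x} → Covers N x ⊎ x ≡ a → x ≢ b → Covers ((a , EP.partner) ∷ S.N′) x
    N′-covers⁺ (inj₂ refl) _ = here refl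
    N′-covers⁺ (inj₁ c) x≢b with EN.covers-split c
    ... | inj₁ x≡p        = there (here x≡p)
    ... | inj₂ (inj₁ x≡q) = there (there (S.N′-covers⁺ (inj₂ x≡q) x≢b))
    ... | inj₂ (inj₂ c′)  = there (there (S.N′-covers⁺ (inj₁ c′) x≢b))

    P′-covers⁻ : ∀ {x} → Covers ((EP.partner , EN.partner) ∷ S.P′) x → (Covers P x ⊎ x ≡ b) × x ≢ a
    P′-covers⁻ (here refl)         = inj₁ EP.partner∈M , EP.x≢partner ∘ ≡-sym
    P′-covers⁻ (there (here refl)) = q∈P⊎q≡b , q≢a
    P′-covers⁻ (there (there c))   with proj₁ (S.P′-covers⁻ c)
    ... | inj₁ c′   = inj₁ (EP.covers-rest c′) , λ { refl → EP.x∉rest c′ }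
    ... | inj₂ x≡b  = inj₂ x≡b , λ { refl → b≢a (≡-sym x≡b) }

  augmenting-∷ : ∀ {P N N₀ : Edges m} {a} (ep : MatchedAt P a) → IsMatching E N₀ → length N₀ ≡ length N →
                 (∀ {x} → Covers N₀ x → Covers N x ⊎ Covers P x) →
                 ¬ Covers N₀ a → ¬ Covers N₀ (partner ep) → Alternation P N a
  augmenting-∷ ep matN₀ len N₀⊆N∪P a∉N₀ p∉N₀ =
    augmenting _ (matching-∷ EP.edge EP.x≢partner a∉N₀ p∉N₀ matN₀) (cong suc len)
      λ { (here refl) → inj₂ EP.x∈M ; (there (here refl)) → inj₂ EP.partner∈M ; (there (there c)) → N₀⊆N∪P c }
    where module EP = MatchedAt ep

  alternate : Symmetric E → ∀ k {P N : Edges m} {a} → length P ≡ k → IsMatching E P → IsMatching E N →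
              Covers P a → ¬ Covers N a → Alternation P N a
  alternate E-sym zero    {[]}    _ _ _ ()
  alternate E-sym (suc k) {P} {N} {a} |P| matP matN a∈P a∉N = at-p (N covers? EP.partner)
    where
    ep : MatchedAt P a
    ep = matchedAt E-sym matP a∈P
    module EP = MatchedAt ep

    at-q : (en : MatchedAt N EP.partner) → Dec (Covers P (partner en)) → Alternation P N a
    at-q en (no q∉P) = switching _ (switch-∷ ep en a∉N (inj₂ refl)
                         (switch-refl EP.rest-matching EN.rest-matching (q∉P ∘ EP.covers-rest) EN.partner∉rest))
      where module EN = MatchedAt en
    at-q en (yes q∈P) = extend (alternate E-sym k (suc-injective (trans (≡-sym EP.length-rest) |P|))
                                  EP.rest-matching EN.rest-matching q∈rest EN.partner∉rest)
      where
      module EN = MatchedAt en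
      q∈rest : Covers EP.rest EN.partner
      q∈rest with EP.covers-split q∈P
      ... | inj₁ refl       = ⊥-elim (a∉N EN.partner∈M)
      ... | inj₂ (inj₁ q≡p) = ⊥-elim (EN.x≢partner (≡-sym q≡p))
      ... | inj₂ (inj₂ c)   = c
      extend : Alternation EP.rest EN.rest EN.partner → Alternation P N a
      extend (augmenting N″ matN″ len N″⊆) =
        augmenting-∷ ep matN″ (trans len (≡-sym EN.length-rest))
          ([ inj₁ ∘ EN.covers-rest , inj₂ ∘ EP.covers-rest ] ∘ N″⊆)
          ([ a∉N ∘ EN.covers-rest , EP.x∉rest ] ∘ N″⊆) ([ EN.x∉rest , EP.partner∉rest ] ∘ N″⊆)
      extend (switching b sw) = switching b (switch-∷ ep en a∉N (inj₁ q∈P) sw)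

    at-p : Dec (Covers N EP.partner) → Alternation P N a
    at-p (no p∉N)  = augmenting-∷ ep matN refl inj₁ a∉N p∉N
    at-p (yes p∈N) = at-q en (P covers? partner en)
      where
      en : MatchedAt N EP.partner
      en = matchedAt E-sym matN p∈N

module _ (G : Graph) where

  private
    V : Set
    V = Fin (n G)

  Matching : Edges (n G) → Set
  Matching = IsMatching (Adj G)

  adjacent⇒distinct : ∀ {u v} → Adj G u v → u ≢ v
  adjacent⇒distinct uv refl = irrefl G uv

  maximum-of-equal-length : ∀ {M M′} → IsMaxMatching G M → Matching M′ →
                            length M′ ≡ length M → IsMaxMatching G M′
  maximum-of-equal-length M-max matM′ len =
    matM′ , λ M″ matM″ → subst (length M″ ≤_) (≡-sym len) (proj₂ M-max M″ matM″)

  longer-than-maximum : ∀ {M M′} → IsMaxMatching G M → Matching M′ → length M′ ≢ suc (length M)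
  longer-than-maximum {M} {M′} M-max matM′ len = 1+n≰n (subst (_≤ length M) len (proj₂ M-max M′ matM′))

  uncovered-nonadjacent : ∀ {M u v} → IsMaxMatching G M → Adj G u v → ¬ Covers M u → ¬ Covers M v → ⊥
  uncovered-nonadjacent M-max uv u∉M v∉M =
    longer-than-maximum M-max (matching-∷ uv (adjacent⇒distinct uv) u∉M v∉M (proj₁ M-max)) refl

  switch-into-maximum : ∀ {P N a} → IsMaxMatching G N → Matching P → Covers P a → ¬ Covers N a →
                        ∃[ b ] Switch {E = Adj G} P N a b
  switch-into-maximum N-max matP a∈P a∉N with alternate (sym G) _ refl matP (proj₁ N-max) a∈P a∉N
  ... | augmenting _ matN′ len _ = ⊥-elim (longer-than-maximum N-max matN′ len)
  ... | switching b sw           = b , sw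

  extend-to-maximum : ∀ {M N} → Matching M → IsMaxMatching G N →
                      ∃[ N* ] IsMaxMatching G N* × (∀ {x} → Covers M x → Covers N* x)
  extend-to-maximum {M} {N} matM N-max =
    let N* , N*-max , sub = go (allFin (n G)) in N* , N*-max , sub (∈-allFin _)
    where
    go : (xs : List V) → ∃[ N* ] IsMaxMatching G N* × (∀ {x} → x ∈ xs → Covers M x → Covers N* x)
    go [] = N , N-max , λ ()
    go (x ∷ xs) with go xs
    ... | N₁ , N₁-max , sub with N₁ covers? x | M covers? x
    ... | yes x∈N₁ | _     = N₁ , N₁-max , λ { (here refl) _ → x∈N₁ ; (there y∈xs) → sub y∈xs }
    ... | no _     | no x∉M = N₁ , N₁-max , λ { (here refl) x∈M → ⊥-elim (x∉M x∈M) ; (there y∈xs) → sub y∈xs }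
    ... | no x∉N₁  | yes x∈M with switch-into-maximum N₁-max matM x∈M x∉N₁
    ... | b , sw = N′ , maximum-of-equal-length N₁-max N′-matching N′-length ,
                   λ { (here refl) y∈M → N′-covers⁺ (inj₂ refl) (≢b y∈M)
                     ; (there y∈xs) y∈M → N′-covers⁺ (inj₁ (sub y∈xs y∈M)) (≢b y∈M) }
      where
      open Switch sw
      ≢b : ∀ {y} → Covers M y → y ≢ b
      ≢b y∈M refl = end-free y∈M

  -- Two neighbours of w missed by N would give, along an alternating path, a maximum
  -- matching missing w together with one of them.
  uncovered-neighbours-coincide : ∀ {N u u′ w} → DG G w → IsMaxMatching G N →
                                  ¬ Covers N u → ¬ Covers N u′ → Adj G u w → Adj G u′ w → u ≡ u′
  uncovered-neighbours-coincide {N} {u} {u′} {w} (P , P-max , w∉P) N-max u∉N u′∉N uw u′w with u ≟ u′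
  ... | yes u≡u′ = u≡u′
  ... | no u≢u′ with P covers? u
  ...   | no u∉P = ⊥-elim (uncovered-nonadjacent P-max uw u∉P w∉P)
  ...   | yes u∈P with switch-into-maximum N-max (proj₁ P-max) u∈P u∉N
  ...     | b , sw with b ≟ w
  ...       | yes refl = ⊥-elim (uncovered-nonadjacent (maximum-of-equal-length N-max N′-matching N′-length)
                                   u′w (λ c → [ u′∉N , u≢u′ ∘ ≡-sym ] (proj₁ (N′-covers⁻ c)))
                                   (λ c → proj₂ (N′-covers⁻ c) refl))
    where open Switch sw
  ...       | no b≢w  = ⊥-elim (uncovered-nonadjacent (maximum-of-equal-length P-max P′-matching P′-length)
                                   uw (λ c → proj₂ (P′-covers⁻ c) refl)
                                   (λ c → [ w∉P , b≢w ∘ ≡-sym ] (proj₁ (P′-covers⁻ c))))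
    where open Switch sw

  no-perfect-matching : ∀ {y M} → DG G y → Matching M → ¬ (∀ x → Covers M x)
  no-perfect-matching {y} (M₀ , M₀-max , y∉M₀) matM covers-all
    with switch-into-maximum M₀-max matM (covers-all y) y∉M₀
  ... | b , sw = Switch.end-free sw (covers-all b)

  matching-cover-≥2 : ∀ {y k} → DG G y → HasMatchingCover G k → 2 ≤ k
  matching-cover-≥2 {y} {zero} _ (_ , _ , covers) with covers y
  ... | () , _
  matching-cover-≥2 {y} {suc zero} y∈D (Ms , mats , covers) =
    ⊥-elim (no-perfect-matching y∈D (mats zero) λ x → only (covers x))
    where
    only : ∀ {x} → ∃[ i ] Covers (Ms i) x → Covers (Ms zero) x
    only (zero , c) = c
  matching-cover-≥2 {k = suc (suc k)} _ _ = s≤s (s≤s z≤n)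

  D? : ∀ {M₀} → IsMaxMatching G M₀ → ∀ x → Dec (DG G x)
  D? {M₀} M₀-max x with any-list-of-length? (length M₀) (λ M → Matching M × ¬ Covers M x)
                                             (λ M → matching? (adj? G) M ×-dec ¬? (M covers? x))
  ... | yes (M , len , matM , x∉M) = yes (M , maximum-of-equal-length M₀-max matM len , x∉M)
  ... | no none = no λ { (M , (matM , M-maximal) , x∉M) →
          none (M , ≤-antisym (proj₂ M₀-max M matM) (M-maximal M₀ (proj₁ M₀-max)) , matM , x∉M) }

  D*-edge : ∀ {x y} → DStar G x → Adj G x y → EStar G x y × EStar G y x
  D*-edge {x} {y} (x∈D , isolated) xy =
    (xy , x∈V* , y∈V* , λ (x∈A , _) → proj₁ x∈A x∈D) ,
    (sym G xy , y∈V* , x∈V* , λ (_ , x∈A) → proj₁ x∈A x∈D)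
    where
    y∉D : ¬ DG G y
    y∉D y∈D = isolated (y , xy , y∈D)
    x∈V* : VStar G x
    x∈V* = (λ (_ , nbr) → isolated nbr) , (λ (_ , x∉D) → x∉D x∈D)
    y∈V* : VStar G y
    y∈V* = (λ (y∈D , _) → y∉D y∈D) , (λ (y∉A , _) → y∉A (y∉D , x , sym G xy , x∈D))

  covered-by-G*-matching : ∀ {M} → IsMatching (EStar G) M → ∀ {x} → Covers M x → VStar G x
  covered-by-G*-matching = covered-satisfies (λ (_ , u∈V* , v∈V* , _) → u∈V* , v∈V*)

  HasDNeighbour : V → Set
  HasDNeighbour x = ∃[ y ] Adj G x y × DG G y

  has-D-neighbour? : ∀ {M₀} → IsMaxMatching G M₀ → ∀ x → Dec (HasDNeighbour x)
  has-D-neighbour? M₀-max x = any? (λ y → adj? G x y ×-dec D? M₀-max y)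

  D*? : ∀ {M₀} → IsMaxMatching G M₀ → ∀ x → Dec (DStar G x)
  D*? M₀-max x = D? M₀-max x ×-dec ¬? (has-D-neighbour? M₀-max x)

  record Restriction (M : Edges (n G)) : Set where
    field
      M*           : Edges (n G)
      M*-matching  : IsMatching (EStar G) M*
      M*⊆M         : ∀ {x} → Covers M* x → Covers M x
      M*-covers-D* : ∀ {x} → DStar G x → Covers M x → Covers M* x

  restriction-∷ : ∀ {M u v} → Restriction M → EStar G u v → u ≢ v → ¬ Covers M u → ¬ Covers M v →
                  Restriction ((u , v) ∷ M)
  restriction-∷ {M} r uv u≢v u∉M v∉M = record
    { M* = _ ∷ M*
    ; M*-matching = matching-∷ uv u≢v (u∉M ∘ M*⊆M) (v∉M ∘ M*⊆M) M*-matching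
    ; M*⊆M = covers-∷⁺ {A = M*} {B = M} M*⊆M
    ; M*-covers-D* = λ { _ (here e) → here e ; _ (there (here e)) → there (here e)
                       ; x∈D* (there (there c)) → there (there (M*-covers-D* x∈D* c)) } }
    where open Restriction r

  -- Keep the edges of M with an end in D*; they are edges of G* by D*-edge.
  restrict : ∀ {M₀} → IsMaxMatching G M₀ → ∀ M → Matching M → Restriction M
  restrict M₀-max [] _ = record { M* = [] ; M*-matching = [] , [] ; M*⊆M = λ c → c ; M*-covers-D* = λ _ c → c }
  restrict M₀-max ((u , v) ∷ M) mat with matching-∷⁻ mat
  ... | uv , u≢v , u∉M , v∉M , matM with restrict M₀-max M matM | D*? M₀-max u | D*? M₀-max v
  ... | r | yes u∈D* | _         = restriction-∷ r (proj₁ (D*-edge u∈D* uv)) u≢v u∉M v∉M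
  ... | r | no _     | yes v∈D*  = restriction-∷ r (proj₂ (D*-edge v∈D* (sym G uv))) u≢v u∉M v∉M
  ... | r | no u∉D*  | no v∉D*   = record
    { M* = M* ; M*-matching = M*-matching ; M*⊆M = there ∘ there ∘ M*⊆M
    ; M*-covers-D* = λ { x∈D* (here refl) → ⊥-elim (u∉D* x∈D*)
                       ; x∈D* (there (here refl)) → ⊥-elim (v∉D* x∈D*)
                       ; x∈D* (there (there c)) → M*-covers-D* x∈D* c } }
    where open Restriction r

  D*-cover-of-cover : ∀ {M₀ k} → IsMaxMatching G M₀ → HasMatchingCover G k → HasMatchingDCover G k
  D*-cover-of-cover M₀-max (Ms , mats , covers) =
    (λ i → M* (r i)) , (λ i → M*-matching (r i)) ,
    λ x x∈D* → let i , c = covers x in i , M*-covers-D* (r i) x∈D* c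
    where
    open Restriction
    r : ∀ i → Restriction (Ms i)
    r i = restrict M₀-max (Ms i) (mats i)

  D*-cover-suc : ∀ {k} → HasMatchingDCover G k → HasMatchingDCover G (suc k)
  D*-cover-suc {k} (Ms , mats , covers) = Ms′ , mats′ , λ x x∈D* → let i , c = covers x x∈D* in suc i , c
    where
    Ms′ : Fin (suc k) → Edges (n G)
    Ms′ zero    = []
    Ms′ (suc i) = Ms i
    mats′ : ∀ i → IsMatching (EStar G) (Ms′ i)
    mats′ zero    = [] , []
    mats′ (suc i) = mats i

  D*-cover-mono : ∀ {d k} → d ≤ k → HasMatchingDCover G d → HasMatchingDCover G k
  D*-cover-mono d≤k = go (≤⇒≤′ d≤k)
    where
    go : ∀ {d k} → d ≤′ k → HasMatchingDCover G d → HasMatchingDCover G k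
    go ≤′-refl      cover = cover
    go (≤′-step d≤k) cover = D*-cover-suc (go d≤k cover)

  record Pairing (N : Edges (n G)) (xs : List V) : Set where
    field
      pairs            : Edges (n G)
      pairs-matching   : Matching pairs
      pairs-nontrivial : ∀ {x} → Covers pairs x → InNontrivialD G x
      pairs-free       : ∀ {x} → Covers pairs x → ¬ Covers N x → x ∈ xs
      pairs-matched    : ∀ {x} → Covers pairs x → Covers N x → ∃[ u ] u ∈ xs × ¬ Covers N u × Adj G u x
      pairs-cover      : ∀ {x} → x ∈ xs → ¬ Covers N x → HasDNeighbour x → Covers pairs x

  pairing-skip : ∀ {N xs u} → Pairing N xs → (¬ Covers N u → ¬ HasDNeighbour u) → Pairing N (u ∷ xs)
  pairing-skip p u-unpaired = record
    { pairs = pairs ; pairs-matching = pairs-matching ; pairs-nontrivial = pairs-nontrivial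
    ; pairs-free = λ c x∉N → there (pairs-free c x∉N)
    ; pairs-matched = λ c x∈N → let u , u∈xs , rest = pairs-matched c x∈N in u , there u∈xs , rest
    ; pairs-cover = λ { (here refl) x∉N nbr → ⊥-elim (u-unpaired x∉N nbr) ; (there x∈xs) → pairs-cover x∈xs } }
    where open Pairing p

  pairing-∷ : ∀ {N xs u w} → IsMaxMatching G N → ¬ u ∈ xs → Pairing N xs →
              ¬ Covers N u → Adj G u w → DG G w → Covers N w → Pairing N (u ∷ xs)
  pairing-∷ {N} {xs} {u} {w} N-max u∉xs p u∉N uw w∈D w∈N = record
    { pairs = (u , w) ∷ pairs
    ; pairs-matching = matching-∷ uw (adjacent⇒distinct uw) u∉pairs w∉pairs pairs-matching
    ; pairs-nontrivial = λ { (here refl) → u∈D , w , uw , w∈D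
                           ; (there (here refl)) → w∈D , u , sym G uw , u∈D
                           ; (there (there c)) → pairs-nontrivial c }
    ; pairs-free = λ { (here refl) _ → here refl
                     ; (there (here refl)) x∉N → ⊥-elim (x∉N w∈N)
                     ; (there (there c)) x∉N → there (pairs-free c x∉N) }
    ; pairs-matched = λ { (here refl) x∈N → ⊥-elim (u∉N x∈N)
                        ; (there (here refl)) _ → u , here refl , u∉N , uw
                        ; (there (there c)) x∈N → let u′ , u′∈xs , rest = pairs-matched c x∈N in u′ , there u′∈xs , rest }
    ; pairs-cover = λ { (here refl) _ _ → here refl ; (there x∈xs) x∉N nbr → there (there (pairs-cover x∈xs x∉N nbr)) } }
    where
    open Pairing p
    u∈D : DG G u
    u∈D = N , N-max , u∉N
    u∉pairs : ¬ Covers pairs u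
    u∉pairs c = u∉xs (pairs-free c u∉N)
    w∉pairs : ¬ Covers pairs w
    w∉pairs c with pairs-matched c w∈N
    ... | u′ , u′∈xs , u′∉N , u′w with uncovered-neighbours-coincide w∈D N-max u∉N u′∉N uw u′w
    ...   | refl = u∉xs u′∈xs

  pairing : ∀ {N} → IsMaxMatching G N → (xs : List V) → Unique xs → Pairing N xs
  pairing N-max [] [] = record
    { pairs = [] ; pairs-matching = [] , [] ; pairs-nontrivial = λ () ; pairs-free = λ ()
    ; pairs-matched = λ () ; pairs-cover = λ () }
  pairing {N} N-max (u ∷ xs) (u∉xs ∷ unique) with pairing N-max xs unique | N covers? u
  ... | p | yes u∈N = pairing-skip p (λ u∉N _ → u∉N u∈N)
  ... | p | no u∉N with has-D-neighbour? N-max u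
  ...   | no none = pairing-skip p (λ _ → none)
  ...   | yes (w , uw , w∈D) with N covers? w
  ...     | no w∉N  = ⊥-elim (uncovered-nonadjacent N-max uw u∉N w∉N)
  ...     | yes w∈N = pairing-∷ N-max (All¬⇒¬Any u∉xs) p u∉N uw w∈D w∈N

  matching-cover-from-D*-cover : ∀ {M₀ k} → IsMaxMatching G M₀ →
                                 HasMatchingDCover G (suc (suc k)) → HasMatchingCover G (suc (suc k))
  matching-cover-from-D*-cover {k = k} M₀-max (Ms , mats , covers-D*) = Ms′ , mats′ , covers
    where
    mats-G : ∀ i → Matching (Ms i)
    mats-G i = matching-mono proj₁ (mats i)

    extension : ∃[ N ] IsMaxMatching G N × (∀ {x} → Covers (Ms zero) x → Covers N x)
    extension = extend-to-maximum (mats-G zero) M₀-max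
    N : Edges (n G)
    N = proj₁ extension
    N-max : IsMaxMatching G N
    N-max = proj₁ (proj₂ extension)
    open Pairing (pairing N-max (allFin (n G)) (allFin⁺ (n G)))

    Ms′ : Fin (suc (suc k)) → Edges (n G)
    Ms′ zero          = N
    Ms′ (suc zero)    = Ms (suc zero) ++ pairs
    Ms′ (suc (suc i)) = Ms (suc (suc i))

    mats′ : ∀ i → Matching (Ms′ i)
    mats′ zero          = proj₁ N-max
    mats′ (suc zero)    = matching-++ (mats-G (suc zero)) pairs-matching
                            λ c c′ → proj₁ (covered-by-G*-matching (mats (suc zero)) c) (pairs-nontrivial c′)
    mats′ (suc (suc i)) = mats-G (suc (suc i))

    covers : ∀ x → ∃[ i ] Covers (Ms′ i) x
    covers x with N covers? x
    ... | yes x∈N = zero , x∈N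
    ... | no x∉N with has-D-neighbour? N-max x
    ...   | yes nbr = suc zero , covers-++⁺ʳ (Ms (suc zero)) (pairs-cover (∈-allFin x) x∉N nbr)
    ...   | no isolated with covers-D* x ((N , N-max , x∉N) , isolated)
    ...     | zero , c          = zero , proj₂ (proj₂ extension) c
    ...     | suc zero , c      = suc zero , covers-++⁺ˡ {A = Ms (suc zero)} {B = pairs} c
    ...     | suc (suc j) , c   = suc (suc j) , c

lemma3 : (G : Graph) → Connected G → ∃[ x ] AG G x →
         (d : ℕ) → IsMD G d →
         (d ≤ 1 → IsMC G 2) × (2 ≤ d → IsMC G d)
lemma3 G _ (_ , _ , y , _ , y∈D@(M₀ , M₀-max , _)) d (D*-cover , d-minimal) = small , large
  where
  small : d ≤ 1 → IsMC G 2
  small d≤1 = matching-cover-from-D*-cover G M₀-max (D*-cover-mono G (≤-trans d≤1 (n≤1+n 1)) D*-cover) ,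
              λ _ → matching-cover-≥2 G y∈D
  large : 2 ≤ d → IsMC G d
  large (s≤s (s≤s _)) = matching-cover-from-D*-cover G M₀-max D*-cover ,
                        λ _ cover → d-minimal _ (D*-cover-of-cover G M₀-max cover)
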